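{- Let $G$ be a finite simple graph and let $M$ be a maximum matching of $G$. Let $v \in V_{SD}(G)$ be a vertex that belongs to an $M$-Jposy. Then there exists an $M$-$mm$-alternating closed walk starting (and ending) at $v$.
   Context: A walk is $M$-alternating if, for each pair of consecutive edges, exactly one belongs to $M$; it is $M$-$mm$-alternating if moreover its first and last edges belong to $M$. An $M$-blossom is an odd cycle of length $2k+1$ containing exactly $k$ edges of $M$; its base is the unique vertex of the cycle not matched by $M$ to another vertex of the cycle. An $M$-Jposy is a configuration (subgraph) consisting of two, not necessarily distinct, $M$-blossoms joined by an odd-length $M$-alternating walk (starting and ending with edges of $M$) whose endpoints are the bases of the two blossoms. Let $\mathcal{M}(G)$ be the set of maximum matchings of $G$; $V_{SD}(G)$ is the set of vertices of $G$ that lie on an $M'$-Jposy for some $M' \in \mathcal{M}(G)$, and the SD-part of $G$ is $G[V_{SD}(G)]$. -}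

module Defs where

open import Data.Nat using (ℕ; zero; suc; _+_; _*_; _≤_; _<_)
open import Data.Fin using (Fin)
open import Data.Fin using (_≟_)
open import Data.Product using (Σ; ∃; _×_; _,_; proj₁; proj₂)
import Data.Product.Properties
open import Data.Sum using (_⊎_)
open import Data.List using (List; []; _∷_; length; filter; upTo; concatMap)
open import Data.List.Relation.Unary.All using (All)
open import Data.List.Relation.Unary.Unique.Propositional using (Unique)
open import Data.List.Membership.Propositional using (_∈_)
import Data.List.Membership.DecPropositional as DecMem
open import Relation.Nullary using (¬_; Dec)
open import Relation.Nullary.Decidable using (_⊎-dec_)
open import Relation.Binary.PropositionalEquality using (_≡_)

record SimpleGraph (n : ℕ) : Set₁ where
  field
    Adj     : Fin n → Fin n → Set
    adjSym  : ∀ {u v} → Adj u v → Adj v u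
    irrefl  : ∀ {u} → ¬ Adj u u
    adjDec  : ∀ u v → Dec (Adj u v)
open SimpleGraph public

module _ {n : ℕ} where

  -- An edge set given as a list of (oriented) pairs {u,v}.
  EdgeList : Set
  EdgeList = List (Fin n × Fin n)

  endpoints : EdgeList → List (Fin n)
  endpoints = concatMap (λ e → proj₁ e ∷ proj₂ e ∷ [])

  -- A matching: a set of edges of G, pairwise vertex-disjoint
  -- (all endpoints distinct; this also forbids repeated edges).
  IsMatching : SimpleGraph n → EdgeList → Set
  IsMatching G M = All (λ e → Adj G (proj₁ e) (proj₂ e)) M × Unique (endpoints M)

  IsMaximumMatching : SimpleGraph n → EdgeList → Set
  IsMaximumMatching G M =
    IsMatching G M × (∀ M′ → IsMatching G M′ → length M′ ≤ length M)

  InM : EdgeList → Fin n → Fin n → Set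
  InM M u v = ((u , v) ∈ M) ⊎ ((v , u) ∈ M)

  inM? : (M : EdgeList) → ∀ u v → Dec (InM M u v)
  inM? M u v = DecMem._∈?_ (Data.Product.Properties.≡-dec _≟_ _≟_) (u , v) M
         ⊎-dec DecMem._∈?_ (Data.Product.Properties.≡-dec _≟_ _≟_) (v , u) M

  record Walk (G : SimpleGraph n) : Set where
    field
      len : ℕ
      vtx : ℕ → Fin n
      adj : ∀ i → i < len → Adj G (vtx i) (vtx (suc i))
  open Walk public

  EdgeInM : ∀ {G} → EdgeList → Walk G → ℕ → Set
  EdgeInM M W i = InM M (vtx W i) (vtx W (suc i))

  Xor : Set → Set → Set
  Xor P Q = (P × ¬ Q) ⊎ (¬ P × Q)

  Alternating : ∀ {G} → EdgeList → Walk G → Set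
  Alternating M W =
    ∀ i → suc i < len W → Xor (EdgeInM M W i) (EdgeInM M W (suc i))

  MMAlternating : ∀ {G} → EdgeList → Walk G → Set
  MMAlternating M W =
    Alternating M W × Σ ℕ (λ k → len W ≡ suc k × EdgeInM M W 0 × EdgeInM M W k)

  Closed : ∀ {G} → Walk G → Set
  Closed W = vtx W 0 ≡ vtx W (len W)

  OnWalk : ∀ {G} → Fin n → Walk G → Set
  OnWalk v W = Σ ℕ (λ i → i ≤ len W × vtx W i ≡ v)

  IsCycle : ∀ {G} → Walk G → Set
  IsCycle W = 3 ≤ len W × Closed W ×
    (∀ i j → i < len W → j < len W → vtx W i ≡ vtx W j → i ≡ j)

  countM : ∀ {G} → EdgeList → Walk G → ℕ
  countM M W = length (filter (λ i → inM? M (vtx W i) (vtx W (suc i))) (upTo (len W)))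

  IsBlossom : ∀ {G} → EdgeList → Walk G → Set
  IsBlossom M C = IsCycle C × Σ ℕ (λ k → len C ≡ suc (2 * k) × countM M C ≡ k)

  -- b is the base of the cycle C: a vertex of C not matched by M to a vertex of C
  -- (for a blossom such a vertex is unique)
  IsBase : ∀ {G} → EdgeList → Walk G → Fin n → Set
  IsBase M C b = Σ ℕ (λ j → j < len C × vtx C j ≡ b ×
    (∀ j′ → j′ < len C → ¬ InM M b (vtx C j′)))

  Odd : ℕ → Set
  Odd m = Σ ℕ (λ k → m ≡ suc (2 * k))

  record Jposy (G : SimpleGraph n) (M : EdgeList) : Set where
    field
      C₁ C₂ : Walk G
      P     : Walk G
      blossom₁ : IsBlossom M C₁
      blossom₂ : IsBlossom M C₂
      P-odd  : Odd (len P)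
      P-alt  : MMAlternating M P
      base₁  : IsBase M C₁ (vtx P 0)
      base₂  : IsBase M C₂ (vtx P (len P))
  open Jposy public

  OnJposy : ∀ {G M} → Fin n → Jposy G M → Set
  OnJposy v J = OnWalk v (C₁ J) ⊎ OnWalk v (C₂ J) ⊎ OnWalk v (P J)

  InVSD : SimpleGraph n → Fin n → Set
  InVSD G v = Σ EdgeList (λ M′ → IsMaximumMatching G M′ ×
                Σ (Jposy G M′) (λ J → OnJposy v J))

module Submission where

-- Read from its base b, a blossom C of length 2k+1 is a closed walk whose first and last edges
-- are not in M (b is matched to no vertex of C); since M is a matching no two consecutive edges
-- of C lie in M, and exactly k do, so the edges must alternate and C is an odd walk from b to b
-- starting and ending with non-M edges.  Cutting these blossoms and the stem P of the Jposy at
-- a vertex v, and choosing each time the direction of the right parity, gives an odd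
-- M-mm-alternating walk R from v to the base b of one of the blossoms C; then R, C and the
-- reverse of R concatenate to the required closed walk.

open import Defs
open import Data.Nat using (ℕ; zero; suc; _+_; _*_; _∸_; _≤_; _<_; z≤n; s≤s; parity)
open import Data.Nat.Properties
open import Data.Parity.Base using (Parity; 0ℙ; 1ℙ; _⁻¹) renaming (_+_ to _⊕_)
open import Data.Parity.Properties using (+-homo-+; *-homo-*; suc-homo-⁻¹)
  renaming (+-assoc to ⊕-assoc; +-identityʳ to ⊕-identityʳ)
open import Data.Empty using (⊥; ⊥-elim)
open import Data.Fin using (Fin)
open import Data.Product using (Σ; _×_; _,_; proj₁; proj₂)
open import Data.Sum using (_⊎_; inj₁; inj₂; [_,_])
open import Data.List using (_∷_; length; filter; applyUpTo)
open import Data.List.Relation.Unary.Any using (here; there)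
open import Data.List.Relation.Unary.All as All using (_∷_)
open import Data.List.Relation.Unary.AllPairs using (_∷_)
open import Data.List.Relation.Unary.Unique.Propositional using (Unique)
open import Data.List.Membership.Propositional using (_∈_)
open import Function using (_∘_)
open import Relation.Nullary using (¬_; Dec; yes; no)
open import Relation.Unary using (Decidable)
open import Relation.Binary.PropositionalEquality
  using (_≡_; refl; sym; trans; cong; cong₂; subst; subst₂; module ≡-Reasoning)

-- Parities

parity-suc : ∀ m → parity (suc m) ≡ parity m ⁻¹
parity-suc = +-homo-+ 1

parity-odd : ∀ k → parity (suc (2 * k)) ≡ 1ℙ
parity-odd k = trans (parity-suc (2 * k)) (cong _⁻¹ (*-homo-* 2 k))

odd⇒suc : ∀ m → parity m ≡ 1ℙ → Σ ℕ (λ k → m ≡ suc k × parity k ≡ 0ℙ)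
odd⇒suc (suc k) odd = k , refl , trans (sym (suc-homo-⁻¹ k)) (cong _⁻¹ odd)

⊕-solveʳ : ∀ a b c → a ⊕ b ≡ c → b ≡ a ⊕ c
⊕-solveʳ 0ℙ b  _ refl = refl
⊕-solveʳ 1ℙ 0ℙ _ refl = refl
⊕-solveʳ 1ℙ 1ℙ _ refl = refl

phase-+ : ∀ s a u → (s ⊕ parity a) ⊕ parity u ≡ s ⊕ parity (a + u)
phase-+ s a u = trans (⊕-assoc s _ _) (cong (s ⊕_) (sym (+-homo-+ a u)))

reverse-phase : ∀ s p q → (s ⊕ (p ⊕ q) ⁻¹ ⁻¹) ⊕ p ≡ s ⊕ q
reverse-phase 0ℙ 0ℙ 0ℙ = refl
reverse-phase 0ℙ 0ℙ 1ℙ = refl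
reverse-phase 0ℙ 1ℙ 0ℙ = refl
reverse-phase 0ℙ 1ℙ 1ℙ = refl
reverse-phase 1ℙ 0ℙ 0ℙ = refl
reverse-phase 1ℙ 0ℙ 1ℙ = refl
reverse-phase 1ℙ 1ℙ 0ℙ = refl
reverse-phase 1ℙ 1ℙ 1ℙ = refl

Truth : Parity → Set → Set
Truth 1ℙ P = P
Truth 0ℙ P = ¬ P

indicator : ∀ {P : Set} → Dec P → Parity
indicator (yes _) = 1ℙ
indicator (no _)  = 0ℙ

truth-indicator : ∀ {P : Set} (P? : Dec P) → Truth (indicator P?) P
truth-indicator (yes p) = p
truth-indicator (no ¬p) = ¬p

indicator-0ℙ : ∀ {P : Set} (P? : Dec P) → ¬ P → indicator P? ≡ 0ℙ
indicator-0ℙ (yes p) ¬p = ⊥-elim (¬p p)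
indicator-0ℙ (no _)  _  = refl

indicator-1ℙ : ∀ {P : Set} (P? : Dec P) → indicator P? ≡ 1ℙ → P
indicator-1ℙ (yes p) _ = p

-- Counting ones in a 0/1 sequence

bit : Parity → ℕ
bit 0ℙ = 0
bit 1ℙ = 1

ones : (ℕ → Parity) → ℕ → ℕ
ones g zero    = 0
ones g (suc m) = bit (g 0) + ones (g ∘ suc) m

ones-+ : ∀ g a b → ones g (a + b) ≡ ones g a + ones (g ∘ (a +_)) b
ones-+ g zero    b = refl
ones-+ g (suc a) b =
  trans (cong (bit (g 0) +_) (ones-+ (g ∘ suc) a b)) (sym (+-assoc (bit (g 0)) _ _))

ones-cong : ∀ {g h} m → (∀ i → i < m → g i ≡ h i) → ones g m ≡ ones h m
ones-cong zero    g≗h = refl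
ones-cong (suc m) g≗h =
  cong₂ _+_ (cong bit (g≗h 0 (s≤s z≤n))) (ones-cong m (λ i i<m → g≗h (suc i) (s≤s i<m)))

ones-skip : ∀ g m → g 0 ≡ 0ℙ → ones g (suc m) ≡ ones (g ∘ suc) m
ones-skip g m g₀ = cong (λ x → bit x + ones (g ∘ suc) m) g₀

ones-take : ∀ g m → g 0 ≡ 1ℙ → ones g (suc m) ≡ suc (ones (g ∘ suc) m)
ones-take g m g₀ = cong (λ x → bit x + ones (g ∘ suc) m) g₀

length-filter-applyUpTo : ∀ {P : ℕ → Set} (P? : Decidable P) h m →
                          length (filter P? (applyUpTo h m)) ≡ ones (λ i → indicator (P? (h i))) m
length-filter-applyUpTo P? h zero    = refl
length-filter-applyUpTo P? h (suc m) with P? (h 0)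
... | yes _ = cong suc (length-filter-applyUpTo P? (h ∘ suc) m)
... | no _  = length-filter-applyUpTo P? (h ∘ suc) m

NoConsecutiveOnes : (ℕ → Parity) → ℕ → Set
NoConsecutiveOnes g m = ∀ t → suc t < m → g t ≡ 1ℙ → g (suc t) ≡ 0ℙ

private
  drop₁ : ∀ {g m} → NoConsecutiveOnes g (suc m) → NoConsecutiveOnes (g ∘ suc) m
  drop₁ noc t t<m = noc (suc t) (s≤s t<m)

  drop₂ : ∀ {g m} → NoConsecutiveOnes g (2 + m) → NoConsecutiveOnes (g ∘ suc ∘ suc) m
  drop₂ noc t t<m = noc (2 + t) (s≤s (s≤s t<m))

ones-bound : ∀ p g → g 0 ≡ 0ℙ → g p ≡ 0ℙ → NoConsecutiveOnes g (suc p) → 2 * ones g (suc p) ≤ p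
ones-bound-tail : ∀ p g x → g 1 ≡ x → g (suc p) ≡ 0ℙ → NoConsecutiveOnes g (2 + p) →
                  2 * ones (g ∘ suc) (suc p) ≤ suc p

ones-bound zero    g g₀ gₚ noc rewrite g₀ = z≤n
ones-bound (suc p) g g₀ gₚ noc =
  ≤-trans (≤-reflexive (cong (2 *_) (ones-skip g (suc p) g₀))) (ones-bound-tail p g (g 1) refl gₚ noc)

ones-bound-tail zero    g _  _  gₚ noc rewrite gₚ = z≤n
ones-bound-tail (suc q) g 0ℙ g₁ gₚ noc =
  ≤-trans (ones-bound (suc q) (g ∘ suc) g₁ gₚ (drop₁ noc)) (n≤1+n _)
ones-bound-tail (suc q) g 1ℙ g₁ gₚ noc = begin
  2 * ones (g ∘ suc) (2 + q)  ≡⟨ cong (2 *_) (ones-take (g ∘ suc) (suc q) g₁) ⟩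
  2 * suc c                   ≡⟨ *-suc 2 c ⟩
  2 + 2 * c                   ≤⟨ s≤s (s≤s (ones-bound q (g ∘ suc ∘ suc) g₂ gₚ (drop₂ noc))) ⟩
  2 + q                       ∎
  where
  open ≤-Reasoning
  c : ℕ
  c = ones (g ∘ suc ∘ suc) (suc q)
  g₂ : g 2 ≡ 0ℙ
  g₂ = noc 1 (s≤s (s≤s (s≤s z≤n))) g₁

ones-rigid : ∀ p g → g 0 ≡ 0ℙ → g p ≡ 0ℙ → NoConsecutiveOnes g (suc p) →
             2 * ones g (suc p) ≡ p → ∀ t → t ≤ p → g t ≡ parity t
ones-rigid-tail : ∀ q g x → g 1 ≡ x → g 0 ≡ 0ℙ → g (2 + q) ≡ 0ℙ → NoConsecutiveOnes g (3 + q) →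
                  2 * ones (g ∘ suc) (2 + q) ≡ 2 + q → ∀ t → t ≤ 2 + q → g t ≡ parity t

ones-rigid zero          g g₀ gₚ noc tight zero z≤n = g₀
ones-rigid (suc zero)    g g₀ gₚ noc tight t t≤1 rewrite g₀ | gₚ with tight
... | ()
ones-rigid (suc (suc q)) g g₀ gₚ noc tight =
  ones-rigid-tail q g (g 1) refl g₀ gₚ noc (trans (cong (2 *_) (sym (ones-skip g (2 + q) g₀))) tight)

ones-rigid-tail q g 0ℙ g₁ g₀ gₚ noc tight = ⊥-elim (1+n≰n (begin
  2 + q                       ≡⟨ tight ⟨
  2 * ones (g ∘ suc) (2 + q)  ≤⟨ ones-bound (suc q) (g ∘ suc) g₁ gₚ (drop₁ noc) ⟩
  suc q                       ∎))
  where open ≤-Reasoning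
ones-rigid-tail q g 1ℙ g₁ g₀ gₚ noc tight = alternating
  where
  c : ℕ
  c = ones (g ∘ suc ∘ suc) (suc q)
  tight′ : 2 * c ≡ q
  tight′ = suc-injective (suc-injective (begin
    2 + 2 * c                   ≡⟨ *-suc 2 c ⟨
    2 * suc c                   ≡⟨ cong (2 *_) (ones-take (g ∘ suc) (suc q) g₁) ⟨
    2 * ones (g ∘ suc) (2 + q)  ≡⟨ tight ⟩
    2 + q                       ∎))
    where open ≡-Reasoning
  g₂ : g 2 ≡ 0ℙ
  g₂ = noc 1 (s≤s (s≤s (s≤s z≤n))) g₁
  alternating : ∀ t → t ≤ 2 + q → g t ≡ parity t
  alternating zero          _               = g₀
  alternating (suc zero)    _               = g₁
  alternating (suc (suc t)) (s≤s (s≤s t≤q)) = ones-rigid q (g ∘ suc ∘ suc) g₂ gₚ (drop₂ noc) tight′ t t≤q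

-- Matchings

module _ {n : ℕ} where

  IncidentTo : Fin n → Fin n × Fin n → Set
  IncidentTo x e = x ≡ proj₁ e ⊎ x ≡ proj₂ e

  ∈-endpoints : ∀ {M : EdgeList} {e x} → e ∈ M → IncidentTo x e → x ∈ endpoints M
  ∈-endpoints (here refl) (inj₁ refl) = here refl
  ∈-endpoints (here refl) (inj₂ refl) = there (here refl)
  ∈-endpoints (there e∈M) x∈e         = there (there (∈-endpoints e∈M x∈e))

  private
    head-∉-tail : ∀ {a b x} {M : EdgeList} → Unique (a ∷ b ∷ endpoints M) →
                  IncidentTo x (a , b) → x ∈ endpoints M → ⊥
    head-∉-tail ((_ ∷ a∉) ∷ _) (inj₁ refl) x∈M = All.lookup a∉ x∈M refl
    head-∉-tail (_ ∷ b∉ ∷ _)   (inj₂ refl) x∈M = All.lookup b∉ x∈M refl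

  incident-edge-unique : ∀ {M : EdgeList} {e e′ x} → Unique (endpoints M) → e ∈ M → e′ ∈ M →
                         IncidentTo x e → IncidentTo x e′ → e ≡ e′
  incident-edge-unique         u           (here refl) (here refl)  _   _    = refl
  incident-edge-unique {_ ∷ M} u           (here refl) (there e′∈M) x∈e x∈e′ =
    ⊥-elim (head-∉-tail {M = M} u x∈e (∈-endpoints e′∈M x∈e′))
  incident-edge-unique {_ ∷ M} u           (there e∈M) (here refl)  x∈e x∈e′ =
    ⊥-elim (head-∉-tail {M = M} u x∈e′ (∈-endpoints e∈M x∈e))
  incident-edge-unique {_ ∷ M} (_ ∷ _ ∷ u) (there e∈M) (there e′∈M) x∈e x∈e′ =
    incident-edge-unique {M} u e∈M e′∈M x∈e x∈e′

  InM-sym : ∀ {M : EdgeList} {x y : Fin n} → InM M x y → InM M y x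
  InM-sym (inj₁ xy∈M) = inj₂ xy∈M
  InM-sym (inj₂ yx∈M) = inj₁ yx∈M

  partner-unique : ∀ {M : EdgeList} {x y z : Fin n} → Unique (endpoints M) →
                   InM M x y → InM M x z → y ≡ z
  partner-unique u (inj₁ p) (inj₁ q) = cong proj₂ (incident-edge-unique u p q (inj₁ refl) (inj₁ refl))
  partner-unique u (inj₁ p) (inj₂ q) = trans (cong proj₂ e≡e′) (cong proj₁ e≡e′)
    where e≡e′ = incident-edge-unique u p q (inj₁ refl) (inj₂ refl)
  partner-unique u (inj₂ p) (inj₁ q) = trans (cong proj₁ e≡e′) (cong proj₂ e≡e′)
    where e≡e′ = incident-edge-unique u p q (inj₂ refl) (inj₁ refl)
  partner-unique u (inj₂ p) (inj₂ q) = cong proj₁ (incident-edge-unique u p q (inj₂ refl) (inj₂ refl))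

-- Operations on walks

module _ {n : ℕ} where

  splice : ℕ → (ℕ → Fin n) → (ℕ → Fin n) → ℕ → Fin n
  splice zero    f g i       = g i
  splice (suc a) f g zero    = f zero
  splice (suc a) f g (suc i) = splice a (f ∘ suc) g i

  splice-≤ : ∀ a f g {i} → f a ≡ g 0 → i ≤ a → splice a f g i ≡ f i
  splice-≤ zero    f g fa≡g0 z≤n     = sym fa≡g0
  splice-≤ (suc a) f g fa≡g0 z≤n     = refl
  splice-≤ (suc a) f g fa≡g0 (s≤s p) = splice-≤ a (f ∘ suc) g fa≡g0 p

  splice-+ : ∀ a f g u → splice a f g (a + u) ≡ g u
  splice-+ zero    f g u = refl
  splice-+ (suc a) f g u = splice-+ a (f ∘ suc) g u

  splice-edges : (P : ℕ → Fin n → Fin n → Set) → ∀ a m f g → f a ≡ g 0 →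
                 (∀ i → i < a → P i (f i) (f (suc i))) →
                 (∀ u → u < m → P (a + u) (g u) (g (suc u))) →
                 ∀ i → i < a + m → P i (splice a f g i) (splice a f g (suc i))
  splice-edges P zero    m f g _     _  Pg i       i<m     = Pg i i<m
  splice-edges P (suc a) m f g fa≡g0 Pf Pg zero    _       =
    subst (P 0 (f 0)) (sym (splice-≤ a (f ∘ suc) g fa≡g0 z≤n)) (Pf 0 (s≤s z≤n))
  splice-edges P (suc a) m f g fa≡g0 Pf Pg (suc i) (s≤s p) =
    splice-edges (P ∘ suc) a m (f ∘ suc) g fa≡g0 (λ i i<a → Pf (suc i) (s≤s i<a)) Pg i p

∸-suc : ∀ {i m} → i < m → m ∸ i ≡ suc (m ∸ suc i)
∸-suc = +-∸-assoc 1

∸-suc-< : ∀ {i m} → i < m → m ∸ suc i < m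
∸-suc-< {i} {m} i<m = ≤-trans (≤-reflexive (sym (∸-suc i<m))) (m∸n≤m m i)

module _ {n : ℕ} {G : SimpleGraph n} where

  append : (A B : Walk G) → vtx A (len A) ≡ vtx B 0 → Walk G
  append A B junction = record
    { len = len A + len B
    ; vtx = splice (len A) (vtx A) (vtx B)
    ; adj = splice-edges (λ _ → Adj G) (len A) (len B) (vtx A) (vtx B) junction (adj A) (adj B)
    }

  segment : (A : Walk G) (t m : ℕ) → t + m ≤ len A → Walk G
  segment A t m t+m≤len = record
    { len = m
    ; vtx = λ i → vtx A (t + i)
    ; adj = λ i i<m → subst (Adj G (vtx A (t + i)) ∘ vtx A) (sym (+-suc t i))
                            (adj A (t + i) (<-≤-trans (+-monoʳ-< t i<m) t+m≤len))
    }

  reverse : Walk G → Walk G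
  reverse A = record
    { len = len A
    ; vtx = λ i → vtx A (len A ∸ i)
    ; adj = λ i i<len → subst₂ (Adj G) (cong (vtx A) (sym (∸-suc i<len))) refl
                          (adjSym G (adj A (len A ∸ suc i) (∸-suc-< i<len)))
    }

  module Rotation (C : Walk G) (closed : Closed C) (j a : ℕ) (j+a≡len : j + a ≡ len C) where

    junction : vtx C (j + a) ≡ vtx C 0
    junction = trans (cong (vtx C) j+a≡len) (sym closed)

    j≤len : j ≤ len C
    j≤len = subst (j ≤_) j+a≡len (m≤m+n j a)

    rotated : Walk G
    rotated = append (segment C j a (≤-reflexive j+a≡len)) (segment C 0 j j≤len) junction

    rotated-len : len rotated ≡ len C
    rotated-len = trans (+-comm a j) j+a≡len

    rotated-≤ : ∀ {i} → i ≤ a → vtx rotated i ≡ vtx C (j + i)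
    rotated-≤ = splice-≤ a (λ i → vtx C (j + i)) (vtx C) junction

    rotated-+ : ∀ u → vtx rotated (a + u) ≡ vtx C u
    rotated-+ = splice-+ a (λ i → vtx C (j + i)) (vtx C)

    j+i<len : ∀ {i} → i < a → j + i < len C
    j+i<len i<a = <-≤-trans (+-monoʳ-< j i<a) (≤-reflexive j+a≡len)

    u<len : ∀ {u} → u < j → u < len C
    u<len u<j = <-≤-trans u<j j≤len

    rotated-position : ∀ i → i < len rotated →
                       (i < a × vtx rotated i ≡ vtx C (j + i)) ⊎
                       Σ ℕ (λ u → i ≡ a + u × u < j × vtx rotated i ≡ vtx C u)
    rotated-position i i<len with <-≤-connex i a
    ... | inj₁ i<a = inj₁ (i<a , rotated-≤ (<⇒≤ i<a))
    ... | inj₂ a≤i with m≤n⇒∃[o]m+o≡n a≤i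
    ...   | u , refl = inj₂ (u , refl , +-cancelˡ-< a u j i<len , rotated-+ u)

    rotated-vertex : ∀ i → i < len rotated → Σ ℕ (λ e → e < len C × vtx rotated i ≡ vtx C e)
    rotated-vertex i i<len with rotated-position i i<len
    ... | inj₁ (i<a , eq)         = j + i , j+i<len i<a , eq
    ... | inj₂ (u , _ , u<j , eq) = u , u<len u<j , eq

    on-rotated : ∀ {v} → OnWalk v C → OnWalk v rotated
    on-rotated (i , i≤len , Ci≡v) with <-≤-connex i j
    ... | inj₁ i<j = a + i , +-monoʳ-≤ a (<⇒≤ i<j) , trans (rotated-+ i) Ci≡v
    ... | inj₂ j≤i with m≤n⇒∃[o]m+o≡n j≤i
    ...   | u , refl = u , ≤-trans u≤a (m≤m+n a j) , trans (rotated-≤ u≤a) Ci≡v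
      where
      u≤a : u ≤ a
      u≤a = +-cancelˡ-≤ j u a (subst (j + u ≤_) (sym j+a≡len) i≤len)

    rotated-isCycle : IsCycle C → IsCycle rotated
    rotated-isCycle (3≤len , _ , injective) =
      subst (3 ≤_) (sym rotated-len) 3≤len , rotated-closed , rotated-injective
      where
      rotated-closed : Closed rotated
      rotated-closed = trans (rotated-≤ z≤n) (trans (cong (vtx C) (+-identityʳ j)) (sym (rotated-+ j)))

      segment≢prefix : ∀ {i u} → i < a → u < j → vtx C (j + i) ≡ vtx C u → ⊥
      segment≢prefix {i} i<a u<j eq =
        <-irrefl (sym (injective _ _ (j+i<len i<a) (u<len u<j) eq)) (<-≤-trans u<j (m≤m+n j i))

      rotated-injective : ∀ i i′ → i < len rotated → i′ < len rotated →
                          vtx rotated i ≡ vtx rotated i′ → i ≡ i′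
      rotated-injective i i′ i<len i′<len eq with rotated-position i i<len | rotated-position i′ i′<len
      ... | inj₁ (i<a , eqᵢ) | inj₁ (i′<a , eqᵢ′) =
        +-cancelˡ-≡ j i i′ (injective _ _ (j+i<len i<a) (j+i<len i′<a) (trans (sym eqᵢ) (trans eq eqᵢ′)))
      ... | inj₁ (i<a , eqᵢ) | inj₂ (_ , _ , u′<j , eqᵢ′) =
        ⊥-elim (segment≢prefix i<a u′<j (trans (sym eqᵢ) (trans eq eqᵢ′)))
      ... | inj₂ (_ , _ , u<j , eqᵢ) | inj₁ (i′<a , eqᵢ′) =
        ⊥-elim (segment≢prefix i′<a u<j (trans (sym eqᵢ′) (trans (sym eq) eqᵢ)))
      ... | inj₂ (u , refl , u<j , eqᵢ) | inj₂ (u′ , refl , u′<j , eqᵢ′) =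
        cong (a +_) (injective u u′ (u<len u<j) (u<len u′<j) (trans (sym eqᵢ) (trans eq eqᵢ′)))

-- Alternating walks

module _ {n : ℕ} {G : SimpleGraph n} (M : EdgeList {n}) where

  -- Phase 1ℙ: the first edge is in M; phase 0ℙ: it is not.
  Alternates : Parity → Walk G → Set
  Alternates s W = ∀ i → i < len W → Truth (s ⊕ parity i) (EdgeInM M W i)

  truth-InM-sym : ∀ p {x y : Fin n} → Truth p (InM M x y) → Truth p (InM M y x)
  truth-InM-sym 1ℙ xy∈M      = InM-sym xy∈M
  truth-InM-sym 0ℙ xy∉M yx∈M = xy∉M (InM-sym yx∈M)

  append-alternates : ∀ s A B junction → Alternates s A → Alternates (s ⊕ parity (len A)) B →
                      Alternates s (append A B junction)
  append-alternates s A B junction altA altB =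
    splice-edges (λ i x y → Truth (s ⊕ parity i) (InM M x y)) (len A) (len B) (vtx A) (vtx B) junction altA
      (λ u u<len → subst (λ p → Truth p (EdgeInM M B u)) (phase-+ s (len A) u) (altB u u<len))

  segment-alternates : ∀ s A t m t+m≤len → Alternates s A →
                       Alternates (s ⊕ parity t) (segment A t m t+m≤len)
  segment-alternates s A t m t+m≤len altA i i<m =
    subst₂ (λ p k → Truth p (InM M (vtx A (t + i)) (vtx A k))) (sym (phase-+ s t i)) (sym (+-suc t i))
           (altA (t + i) (<-≤-trans (+-monoʳ-< t i<m) t+m≤len))

  reverse-alternates : ∀ s A → Alternates s A → Alternates (s ⊕ parity (len A) ⁻¹) (reverse A)
  reverse-alternates s A altA i i<len =
    subst₂ (λ p k → Truth p (InM M (vtx A k) (vtx A d))) phase (sym (∸-suc i<len))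
           (truth-InM-sym (s ⊕ parity d) (altA d (∸-suc-< i<len)))
    where
    d : ℕ
    d = len A ∸ suc i
    shifted : Parity → Parity
    shifted q = (s ⊕ q ⁻¹) ⊕ parity i
    phase : s ⊕ parity d ≡ shifted (parity (len A))
    phase = begin
      s ⊕ parity d                          ≡⟨ reverse-phase s (parity i) (parity d) ⟨
      shifted ((parity i ⊕ parity d) ⁻¹)    ≡⟨ cong (shifted ∘ _⁻¹) (+-homo-+ i d) ⟨
      shifted (parity (i + d) ⁻¹)           ≡⟨ cong shifted (parity-suc (i + d)) ⟨
      shifted (parity (suc i + d))          ≡⟨ cong (shifted ∘ parity) (m+[n∸m]≡n i<len) ⟩
      shifted (parity (len A))              ∎
      where open ≡-Reasoning

  xor-truth : ∀ p {P Q : Set} → Xor {n = n} P Q → Truth p P → Truth (p ⁻¹) Q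
  xor-truth 1ℙ (inj₁ (_ , ¬q)) _  = ¬q
  xor-truth 1ℙ (inj₂ (¬p , _)) p  = ⊥-elim (¬p p)
  xor-truth 0ℙ (inj₁ (p , _))  ¬p = ⊥-elim (¬p p)
  xor-truth 0ℙ (inj₂ (_ , q))  _  = q

  truth-xor : ∀ p {P Q : Set} → Truth p P → Truth (p ⁻¹) Q → Xor {n = n} P Q
  truth-xor 1ℙ p  ¬q = inj₁ (p , ¬q)
  truth-xor 0ℙ ¬p q  = inj₂ (¬p , q)

  MMAlternating⇒alternates : ∀ {W} → MMAlternating M W → Alternates 1ℙ W
  MMAlternating⇒alternates     (_ , _ , _ , first∈M , _) zero    _     = first∈M
  MMAlternating⇒alternates {W} mm@(alt , _)             (suc i) i<len =
    subst (λ p → Truth (1ℙ ⊕ p) (EdgeInM M W (suc i))) (sym (parity-suc i))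
      (xor-truth (1ℙ ⊕ parity i) (alt i i<len) (MMAlternating⇒alternates {W} mm i (<-trans (n<1+n i) i<len)))

  alternates⇒MMAlternating : ∀ {W} → Alternates 1ℙ W → parity (len W) ≡ 1ℙ → MMAlternating M W
  alternates⇒MMAlternating {W} alt odd with odd⇒suc (len W) odd
  ... | k , len≡ , even-k = alternating , k , len≡ , alt 0 (subst (0 <_) (sym len≡) (s≤s z≤n)) , last∈M
    where
    last∈M : EdgeInM M W k
    last∈M = subst (λ p → Truth (1ℙ ⊕ p) (EdgeInM M W k)) even-k (alt k (subst (k <_) (sym len≡) ≤-refl))
    alternating : Alternating M W
    alternating i 1+i<len =
      truth-xor (1ℙ ⊕ parity i) (alt i (<-trans (n<1+n i) 1+i<len))
        (subst (λ p → Truth (1ℙ ⊕ p) (EdgeInM M W (suc i))) (parity-suc i) (alt (suc i) 1+i<len))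

  record AltWalk (s p : Parity) (u v : Fin n) : Set where
    field
      walk       : Walk G
      alternates : Alternates s walk
      parity-len : parity (len walk) ≡ p
      starts     : vtx walk 0 ≡ u
      ends       : vtx walk (len walk) ≡ v
  open AltWalk

  _⨾_ : ∀ {s p q u v w} → AltWalk s p u v → AltWalk (s ⊕ p) q v w → AltWalk s (p ⊕ q) u w
  _⨾_ {s} A B = record
    { walk       = append (walk A) (walk B) junction
    ; alternates = append-alternates s (walk A) (walk B) junction (alternates A)
                     (subst (λ p → Alternates p (walk B)) (cong (s ⊕_) (sym (parity-len A))) (alternates B))
    ; parity-len = trans (+-homo-+ (len (walk A)) (len (walk B))) (cong₂ _⊕_ (parity-len A) (parity-len B))
    ; starts     = trans (splice-≤ (len (walk A)) (vtx (walk A)) (vtx (walk B)) junction z≤n) (starts A)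
    ; ends       = trans (splice-+ (len (walk A)) (vtx (walk A)) (vtx (walk B)) (len (walk B))) (ends B)
    }
    where
    junction : vtx (walk A) (len (walk A)) ≡ vtx (walk B) 0
    junction = trans (ends A) (sym (starts B))

  reverseᵃ : ∀ {s p u v} → AltWalk s p u v → AltWalk (s ⊕ p ⁻¹) p v u
  reverseᵃ {s} A = record
    { walk       = reverse (walk A)
    ; alternates = subst (λ p → Alternates (s ⊕ p ⁻¹) (reverse (walk A))) (parity-len A)
                     (reverse-alternates s (walk A) (alternates A))
    ; parity-len = parity-len A
    ; starts     = ends A
    ; ends       = trans (cong (vtx (walk A)) (n∸n≡0 (len (walk A)))) (starts A)
    }

  splitAt : ∀ {s p u v x} (W : AltWalk s p u v) t → t ≤ len (walk W) → vtx (walk W) t ≡ x →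
            AltWalk s (parity t) u x × AltWalk (s ⊕ parity t) (parity t ⊕ p) x v
  splitAt {s} {p} W t t≤len Wt≡x with m≤n⇒∃[o]m+o≡n t≤len
  ... | m , t+m≡len = prefix , suffix
    where
    prefix : AltWalk s (parity t) _ _
    prefix = record
      { walk       = segment (walk W) 0 t t≤len
      ; alternates = subst (λ q → Alternates q (segment (walk W) 0 t t≤len)) (⊕-identityʳ s)
                       (segment-alternates s (walk W) 0 t t≤len (alternates W))
      ; parity-len = refl
      ; starts     = starts W
      ; ends       = Wt≡x
      }
    suffix : AltWalk (s ⊕ parity t) (parity t ⊕ p) _ _
    suffix = record
      { walk       = segment (walk W) t m (≤-reflexive t+m≡len)
      ; alternates = segment-alternates s (walk W) t m (≤-reflexive t+m≡len) (alternates W)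
      ; parity-len = ⊕-solveʳ (parity t) (parity m) p
                       (trans (sym (+-homo-+ t m)) (trans (cong parity t+m≡len) (parity-len W)))
      ; starts     = trans (cong (vtx (walk W)) (+-identityʳ t)) Wt≡x
      ; ends       = trans (cong (vtx (walk W)) t+m≡len) (ends W)
      }

  to-base : ∀ {b v} (F : AltWalk 0ℙ 1ℙ b b) → OnWalk v (walk F) → AltWalk 1ℙ 0ℙ v b
  to-base F (t , t≤len , Ft≡v) = choose (parity t) (splitAt F t t≤len Ft≡v)
    where
    choose : ∀ {b v} q → AltWalk 0ℙ q b v × AltWalk q (q ⊕ 1ℙ) v b → AltWalk 1ℙ 0ℙ v b
    choose 0ℙ (prefix , _) = reverseᵃ prefix
    choose 1ℙ (_ , suffix) = suffix

  to-endpoint : ∀ {b₁ b₂ v} (P : AltWalk 1ℙ 1ℙ b₁ b₂) → OnWalk v (walk P) →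
                AltWalk 1ℙ 1ℙ v b₁ ⊎ AltWalk 1ℙ 1ℙ v b₂
  to-endpoint P (t , t≤len , Pt≡v) = choose (parity t) (splitAt P t t≤len Pt≡v)
    where
    choose : ∀ {b₁ b₂ v} q → AltWalk 1ℙ q b₁ v × AltWalk (1ℙ ⊕ q) (q ⊕ 1ℙ) v b₂ →
             AltWalk 1ℙ 1ℙ v b₁ ⊎ AltWalk 1ℙ 1ℙ v b₂
    choose 0ℙ (_ , suffix) = inj₂ suffix
    choose 1ℙ (prefix , _) = inj₁ (reverseᵃ prefix)

  close-through : ∀ {v b} → AltWalk 1ℙ 1ℙ v b → AltWalk 0ℙ 1ℙ b b → AltWalk 1ℙ 1ℙ v v
  close-through R F = R ⨾ (F ⨾ reverseᵃ R)

  closed-MMAlternating : ∀ {v} → AltWalk 1ℙ 1ℙ v v →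
                         Σ (Walk G) (λ W → MMAlternating M W × Closed W × vtx W 0 ≡ v)
  closed-MMAlternating W =
    walk W , alternates⇒MMAlternating {walk W} (alternates W) (parity-len W) ,
    trans (starts W) (sym (ends W)) , starts W

  -- Blossoms

  edgeIndicator : Walk G → ℕ → Parity
  edgeIndicator W i = indicator (inM? M (vtx W i) (vtx W (suc i)))

  edgeIndicator-truth : ∀ W i → Truth (edgeIndicator W i) (EdgeInM M W i)
  edgeIndicator-truth W i = truth-indicator (inM? M (vtx W i) (vtx W (suc i)))

  edgeIndicator-0ℙ : ∀ W i → ¬ EdgeInM M W i → edgeIndicator W i ≡ 0ℙ
  edgeIndicator-0ℙ W i = indicator-0ℙ (inM? M (vtx W i) (vtx W (suc i)))

  edgeIndicator-1ℙ : ∀ W i → edgeIndicator W i ≡ 1ℙ → EdgeInM M W i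
  edgeIndicator-1ℙ W i = indicator-1ℙ (inM? M (vtx W i) (vtx W (suc i)))

  edgeIndicator-cong : ∀ {W W′ i i′} → vtx W i ≡ vtx W′ i′ → vtx W (suc i) ≡ vtx W′ (suc i′) →
                       edgeIndicator W i ≡ edgeIndicator W′ i′
  edgeIndicator-cong = cong₂ (λ x y → indicator (inM? M x y))

  countM≡ones : ∀ W → countM M W ≡ ones (edgeIndicator W) (len W)
  countM≡ones W = length-filter-applyUpTo (λ i → inM? M (vtx W i) (vtx W (suc i))) (λ i → i) (len W)

  rotated-countM : ∀ C closed j a j+a≡len →
                   countM M (Rotation.rotated C closed j a j+a≡len) ≡ countM M C
  rotated-countM C closed j a j+a≡len = begin
    countM M rotated                                               ≡⟨ countM≡ones rotated ⟩
    ones (edgeIndicator rotated) (a + j)                           ≡⟨ ones-+ (edgeIndicator rotated) a j ⟩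
    ones (edgeIndicator rotated) a + ones (edgeIndicator rotated ∘ (a +_)) j
      ≡⟨ cong₂ _+_ (ones-cong a from-segment) (ones-cong j from-prefix) ⟩
    ones (edgeIndicator C ∘ (j +_)) a + ones (edgeIndicator C) j   ≡⟨ +-comm _ (ones (edgeIndicator C) j) ⟩
    ones (edgeIndicator C) j + ones (edgeIndicator C ∘ (j +_)) a   ≡⟨ ones-+ (edgeIndicator C) j a ⟨
    ones (edgeIndicator C) (j + a)                                 ≡⟨ cong (ones (edgeIndicator C)) j+a≡len ⟩
    ones (edgeIndicator C) (len C)                                 ≡⟨ countM≡ones C ⟨
    countM M C                                                     ∎
    where
    open ≡-Reasoning
    open Rotation C closed j a j+a≡len
    from-segment : ∀ i → i < a → edgeIndicator rotated i ≡ edgeIndicator C (j + i)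
    from-segment i i<a = edgeIndicator-cong {rotated} {C}
      (rotated-≤ (<⇒≤ i<a)) (trans (rotated-≤ i<a) (cong (vtx C) (+-suc j i)))
    from-prefix : ∀ u → u < j → edgeIndicator rotated (a + u) ≡ edgeIndicator C u
    from-prefix u _ = edgeIndicator-cong {rotated} {C}
      (rotated-+ u) (trans (cong (vtx rotated) (sym (+-suc a u))) (rotated-+ (suc u)))

  module _ (matching : Unique (endpoints M)) where

    cycle-consecutive-unmatched : ∀ {W : Walk G} → IsCycle W → ∀ t → suc t < len W →
                                  EdgeInM M W t → ¬ EdgeInM M W (suc t)
    cycle-consecutive-unmatched {W} (3≤len , closed , injective) t 2+t≤len t∈M 1+t∈M
      with m≤n⇒m<n∨m≡n 2+t≤len
    ... | inj₁ 2+t<len = m≢1+n+m t {1} (injective t (2 + t) t<len 2+t<len t≡2+t)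
      where
      t<len : t < len W
      t<len = <-trans (m<n+m t {2} (s≤s z≤n)) 2+t<len
      t≡2+t : vtx W t ≡ vtx W (2 + t)
      t≡2+t = partner-unique matching (InM-sym t∈M) 1+t∈M
    ... | inj₂ 2+t≡len with injective t 0 t<len (<-≤-trans (s≤s z≤n) 3≤len) t≡0
      where
      t<len : t < len W
      t<len = <-≤-trans (m<n+m t {2} (s≤s z≤n)) (≤-reflexive 2+t≡len)
      t≡0 : vtx W t ≡ vtx W 0
      t≡0 = trans (partner-unique matching (InM-sym t∈M) 1+t∈M) (trans (cong (vtx W) 2+t≡len) (sym closed))
    ... | refl with subst (3 ≤_) (sym 2+t≡len) 3≤len
    ...   | s≤s (s≤s ())

    based-blossom-alternates : ∀ {C : Walk G} → IsBlossom M C →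
                               (∀ e → e < len C → ¬ InM M (vtx C 0) (vtx C e)) → Alternates 0ℙ C
    based-blossom-alternates {C} (cycle@(3≤len , closed , _) , k , len≡ , count≡k) base i i<len =
      subst (λ p → Truth p (EdgeInM M C i)) (rigid i (≤-pred (subst (i <_) len≡ i<len)))
            (edgeIndicator-truth C i)
      where
      g : ℕ → Parity
      g = edgeIndicator C
      first-unmatched : g 0 ≡ 0ℙ
      first-unmatched = edgeIndicator-0ℙ C 0 (base 1 (<-≤-trans (s≤s (s≤s z≤n)) 3≤len))
      last-unmatched : g (2 * k) ≡ 0ℙ
      last-unmatched = edgeIndicator-0ℙ C (2 * k) λ last∈M →
        base (2 * k) (subst (2 * k <_) (sym len≡) ≤-refl)
          (InM-sym (subst (InM M (vtx C (2 * k))) (trans (cong (vtx C) (sym len≡)) (sym closed)) last∈M))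
      no-consecutive : NoConsecutiveOnes g (suc (2 * k))
      no-consecutive t 1+t<L gt≡1 = edgeIndicator-0ℙ C (suc t)
        (cycle-consecutive-unmatched {C} cycle t (subst (suc t <_) (sym len≡) 1+t<L)
                                     (edgeIndicator-1ℙ C t gt≡1))
      tight : 2 * ones g (suc (2 * k)) ≡ 2 * k
      tight = cong (2 *_) (trans (cong (ones g) (sym len≡)) (trans (sym (countM≡ones C)) count≡k))
      rigid : ∀ t → t ≤ 2 * k → g t ≡ parity t
      rigid = ones-rigid (2 * k) g first-unmatched last-unmatched no-consecutive tight

    based-blossom-flower : ∀ {C : Walk G} {b} → IsBlossom M C → vtx C 0 ≡ b →
                           (∀ e → e < len C → ¬ InM M (vtx C 0) (vtx C e)) → AltWalk 0ℙ 1ℙ b b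
    based-blossom-flower {C} blossom@((_ , closed , _) , k , len≡ , _) C₀≡b base = record
      { walk       = C
      ; alternates = based-blossom-alternates {C} blossom base
      ; parity-len = trans (cong parity len≡) (parity-odd k)
      ; starts     = C₀≡b
      ; ends       = trans (sym closed) C₀≡b
      }

    blossom-flower : ∀ C {b} → IsBlossom M C → IsBase M C b →
                     Σ (AltWalk 0ℙ 1ℙ b b) (λ F → ∀ {v} → OnWalk v C → OnWalk v (walk F))
    blossom-flower C {b} (cycle@(_ , closed , _) , k , len≡ , count≡k) (j , j<len , Cj≡b , b-unmatched)
      with m≤n⇒∃[o]m+o≡n (<⇒≤ j<len)
    ... | a , j+a≡len = based-blossom-flower {rotated} rotated-blossom rotated₀≡b rotated-base , on-rotated
      where
      open Rotation C closed j a j+a≡len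
      rotated-blossom : IsBlossom M rotated
      rotated-blossom = rotated-isCycle cycle , k , trans rotated-len len≡ ,
                        trans (rotated-countM C closed j a j+a≡len) count≡k
      rotated₀≡b : vtx rotated 0 ≡ b
      rotated₀≡b = trans (rotated-≤ z≤n) (trans (cong (vtx C) (+-identityʳ j)) Cj≡b)
      rotated-base : ∀ e → e < len rotated → ¬ InM M (vtx rotated 0) (vtx rotated e)
      rotated-base e e<len with rotated-vertex e e<len
      ... | e′ , e′<len , eq = b-unmatched e′ e′<len ∘ subst₂ (InM M) rotated₀≡b eq

    blossom-to-base : ∀ C {b v} → IsBlossom M C → IsBase M C b → OnWalk v C → AltWalk 1ℙ 0ℙ v b
    blossom-to-base C blossom base onC = to-base (proj₁ flower) (proj₂ flower onC)
      where flower = blossom-flower C blossom base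

    jposy-stem : (J : Jposy G M) → AltWalk 1ℙ 1ℙ (vtx (P J) 0) (vtx (P J) (len (P J)))
    jposy-stem J = record
      { walk       = P J
      ; alternates = MMAlternating⇒alternates {P J} (P-alt J)
      ; parity-len = trans (cong parity (proj₂ (P-odd J))) (parity-odd (proj₁ (P-odd J)))
      ; starts     = refl
      ; ends       = refl
      }

    jposy-closed-walk : (J : Jposy G M) → ∀ {v} → OnJposy v J → AltWalk 1ℙ 1ℙ v v
    jposy-closed-walk J = closed
      where
      b₁ b₂ : Fin n
      b₁ = vtx (P J) 0
      b₂ = vtx (P J) (len (P J))
      F₁ : AltWalk 0ℙ 1ℙ b₁ b₁
      F₁ = proj₁ (blossom-flower (C₁ J) (blossom₁ J) (base₁ J))
      F₂ : AltWalk 0ℙ 1ℙ b₂ b₂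
      F₂ = proj₁ (blossom-flower (C₂ J) (blossom₂ J) (base₂ J))
      closed : ∀ {v} → OnJposy v J → AltWalk 1ℙ 1ℙ v v
      closed (inj₁ onC₁)        =
        close-through (blossom-to-base (C₁ J) (blossom₁ J) (base₁ J) onC₁ ⨾ jposy-stem J) F₂
      closed (inj₂ (inj₁ onC₂)) =
        close-through (blossom-to-base (C₂ J) (blossom₂ J) (base₂ J) onC₂ ⨾ reverseᵃ (jposy-stem J)) F₁
      closed (inj₂ (inj₂ onP))  =
        [ (λ R → close-through R F₁) , (λ R → close-through R F₂) ] (to-endpoint (jposy-stem J) onP)

mainTheorem2 : {n : ℕ} (G : SimpleGraph n) (M : EdgeList) → IsMaximumMatching G M →
    (v : Fin n) → InVSD G v → (J : Jposy G M) → OnJposy v J →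
    Σ (Walk G) (λ W → MMAlternating M W × Closed W × vtx W 0 ≡ v)
mainTheorem2 G M ((_ , matching) , _) v _ J onJ =
  closed-MMAlternating M (jposy-closed-walk M matching J onJ)
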